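{- Let $G=(V,E)$ be a finite simple graph on $n=|V|$ vertices and write $T\chi^L_G(q)=\sum_\alpha c^L_\alpha(q)M_\alpha$ over compositions $\alpha$ of $n$. Then for every composition $\alpha$ of $n$, $c^L_\alpha(q)=c^L_{\alpha^{rev}}(q)$.
   Context: A labeling of $G$ is a bijection $L:V\to\{1,\dots,n\}$; a proper coloring is $\kappa:V\to\mathbb{Z}_{>0}$ with adjacent vertices colored differently; $\mathrm{asc}^L(\kappa)$ is the number of edges $\{u,v\}$ with $L(u)<L(v)$ and $\kappa(u)<\kappa(v)$. $\chi^L_G(x;q)=\sum_\kappa q^{\mathrm{asc}^L(\kappa)}x^\kappa$ with $x^\kappa=\prod_j x_j^{\#\kappa^{ -1}(j)}$, and $T\chi^L_G(q)=\sum_L\chi^L_G(x;q)$ over all labelings. $M_\alpha=\sum_{i_1<\dots<i_\ell}x_{i_1}^{\alpha_1}\cdots x_{i_\ell}^{\alpha_\ell}$. For $\alpha=(\alpha_1,\dots,\alpha_\ell)$, $\alpha^{rev}=(\alpha_\ell,\dots,\alpha_1)$. -}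

module Defs where

open import Data.Nat using (ℕ; zero; suc; _+_; _≡ᵇ_; _<_)
open import Data.Bool using (Bool; true; false; _∧_; _∨_; not; if_then_else_)
open import Data.Fin using (Fin; zero; suc)
open import Data.Fin.Properties using (_≟_; _<?_)
open import Data.List using (List; []; _∷_; map; concatMap; length; lookup)
open import Data.Nat.ListAction using (sum)
open import Data.List.Relation.Unary.All using (All)
open import Relation.Nullary.Decidable using (⌊_⌋)
open import Relation.Binary.PropositionalEquality using (_≡_)

record SimpleGraph (n : ℕ) : Set where
  field
    adj    : Fin n → Fin n → Bool
    sym    : ∀ u v → adj u v ≡ adj v u
    irrefl : ∀ v → adj v v ≡ false
open SimpleGraph public

_==F_ : ∀ {m} → Fin m → Fin m → Bool
i ==F j = ⌊ i ≟ j ⌋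

_<F_ : ∀ {m} → Fin m → Fin m → Bool
i <F j = ⌊ i <? j ⌋

count : ∀ {n} → (Fin n → Bool) → ℕ
count {zero}  p = 0
count {suc n} p = (if p zero then 1 else 0) + count (λ i → p (suc i))

allB : ∀ {n} → (Fin n → Bool) → Bool
allB {zero}  p = true
allB {suc n} p = p zero ∧ allB (λ i → p (suc i))

sumFin : ∀ {n} → (Fin n → ℕ) → ℕ
sumFin {zero}  f = 0
sumFin {suc n} f = f zero + sumFin (λ i → f (suc i))

consF : ∀ {n m} → Fin m → (Fin n → Fin m) → Fin (suc n) → Fin m
consF i f zero    = i
consF i f (suc x) = f x

allFin' : (m : ℕ) → List (Fin m)
allFin' zero    = []
allFin' (suc m) = zero ∷ map suc (allFin' m)

allFuns : (n m : ℕ) → List (Fin n → Fin m)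
allFuns zero    m = (λ ()) ∷ []
allFuns (suc n) m = concatMap (λ f → map (λ i → consF i f) (allFin' m)) (allFuns n m)

-- A labeling is a bijection L : V → {1,…,n}; here V = Fin n and the labels
-- are Fin n (label i+1 ↔ index i).  For maps Fin n → Fin n, bijective ⇔ injective.
isLabeling : ∀ {n} → (Fin n → Fin n) → Bool
isLabeling L = allB (λ u → allB (λ v → not (L u ==F L v) ∨ (u ==F v)))

isProper : ∀ {n ℓ} → SimpleGraph n → (Fin n → Fin ℓ) → Bool
isProper G κ = allB (λ u → allB (λ v → not (adj G u v) ∨ not (κ u ==F κ v)))

-- asc^L(κ): number of edges {u,v} with L(u) < L(v) and κ(u) < κ(v)
-- (each edge is counted once, via its orientation from smaller to larger label)
asc : ∀ {n ℓ} → SimpleGraph n → (Fin n → Fin n) → (Fin n → Fin ℓ) → ℕ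
asc G L κ = sumFin (λ u → count (λ v → adj G u v ∧ (L u <F L v) ∧ (κ u <F κ v)))

-- x^κ = x_1^{α_1} ⋯ x_ℓ^{α_ℓ}, with colors restricted to {1,…,ℓ}
-- (color j+1 ↔ index j : Fin ℓ)
hasType : ∀ {n} (α : List ℕ) → (Fin n → Fin (length α)) → Bool
hasType α κ = allB (λ j → count (λ v → κ v ==F j) ≡ᵇ lookup α j)

IsComposition : ℕ → List ℕ → Set
IsComposition n α = All (λ a → 0 < a) α × (sum α ≡ n)
  where open import Data.Product using (_×_)

-- Coefficient of q^k in c^L_α(q), the coefficient of M_α in Tχ^L_G(q).
-- Since Tχ^L_G(q) is quasisymmetric, c^L_α(q) is the coefficient of the
-- monomial x_1^{α_1} ⋯ x_ℓ^{α_ℓ}, i.e. the sum over labelings L and proper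
-- colorings κ with x^κ = x_1^{α_1}⋯x_ℓ^{α_ℓ} of q^{asc^L(κ)}.
coeff : ∀ {n} → SimpleGraph n → List ℕ → ℕ → ℕ
coeff {n} G α k =
  sum (map (λ L → sum (map (λ κ →
          if isLabeling L ∧ isProper G κ ∧ hasType α κ ∧ (asc G L κ ≡ᵇ k)
          then 1 else 0)
        (allFuns n (length α))))
      (allFuns n n))

{-# OPTIONS --safe #-}

-- Let ℓ be the length of α. Flipping both orders, (L, κ) ↦ (opposite ∘ L, opposite ∘ κ), that is
-- L ↦ n + 1 − L and κ ↦ ℓ + 1 − κ, is a bijection on pairs of maps. It preserves being a labeling
-- and being proper, turns colourings of type α into colourings of type reverse α, and preserves
-- asc: an edge that ascends from u to v for (L, κ) ascends from v to u for the flipped pair.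

module Submission where

open import Defs hiding (sym)
open import Data.Nat using (ℕ; zero; suc; _+_; _∸_; _≡ᵇ_; _<_; s<s)
open import Data.Nat.Properties using (+-0-commutativeMonoid; ∸-monoʳ-<; +-∸-assoc; n∸n≡0; m<1+n⇒m<n∨m≡n)
open import Data.Bool using (Bool; true; false; _∧_; _∨_; not; if_then_else_)
open import Data.Fin using (Fin; zero; suc; toℕ; opposite; cast)
open import Data.Fin.Properties using (toℕ<n; opposite-prop; opposite-involutive; toℕ-cast; cast-is-id)
open import Data.Fin.Permutation as Perm using (Permutation; _⟨$⟩ʳ_; _⟨$⟩ˡ_; inverseˡ)
open import Data.List using (List; []; _∷_; map; concatMap; length; lookup; reverse; _++_; [_])
open import Data.List.Properties using (map-++; map-cong; map-∘; unfold-reverse; length-reverse)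
open import Data.Maybe using (Maybe; nothing; just)
open import Data.Maybe.Properties using (just-injective)
open import Data.Nat.ListAction using (sum)
open import Data.Nat.ListAction.Properties using (sum-++)
open import Data.Sum using (inj₁; inj₂)
open import Function using (_∘_; flip; _⇔_; mk⇔)
open import Relation.Binary using (_Preserves_⟶_)
open import Relation.Nullary using (Dec)
open import Relation.Nullary.Decidable using (⌊_⌋; isYes≗does; does-⇔)
open import Relation.Binary.PropositionalEquality hiding ([_])
open ≡-Reasoning

import Algebra.Properties.CommutativeMonoid.Sum as CommutativeMonoidSum
module ∑ = CommutativeMonoidSum +-0-commutativeMonoid

private
  variable
    A : Set
    m n ℓ : ℕ

sumFin≡sum : (f : Fin n → ℕ) → sumFin f ≡ ∑.sum f
sumFin≡sum {zero}  f = refl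
sumFin≡sum {suc n} f = cong (f zero +_) (sumFin≡sum (f ∘ suc))

sumFin-cong : {f g : Fin n → ℕ} → f ≗ g → sumFin f ≡ sumFin g
sumFin-cong {zero}  f≗g = refl
sumFin-cong {suc n} f≗g = cong₂ _+_ (f≗g zero) (sumFin-cong (f≗g ∘ suc))

sumFin-permute : (f : Fin n → ℕ) (π : Permutation m n) → sumFin f ≡ sumFin (f ∘ (π ⟨$⟩ʳ_))
sumFin-permute f π = begin
  sumFin f                  ≡⟨ sumFin≡sum f ⟩
  ∑.sum f                   ≡⟨ ∑.sum-permute f π ⟩
  ∑.sum (f ∘ (π ⟨$⟩ʳ_))     ≡⟨ sumFin≡sum (f ∘ (π ⟨$⟩ʳ_)) ⟨
  sumFin (f ∘ (π ⟨$⟩ʳ_))    ∎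

sumFin-comm : (f : Fin m → Fin n → ℕ) →
              sumFin (λ i → sumFin (f i)) ≡ sumFin (λ j → sumFin (λ i → f i j))
sumFin-comm f = begin
  sumFin (λ i → sumFin (f i))              ≡⟨ sumFin²≡sum² f ⟩
  ∑.sum (λ i → ∑.sum (f i))                ≡⟨ ∑.∑-comm f ⟩
  ∑.sum (λ j → ∑.sum (λ i → f i j))        ≡⟨ sumFin²≡sum² (flip f) ⟨
  sumFin (λ j → sumFin (λ i → f i j))      ∎
  where
  sumFin²≡sum² : (g : Fin m → Fin n → ℕ) → sumFin (λ i → sumFin (g i)) ≡ ∑.sum (λ i → ∑.sum (g i))
  sumFin²≡sum² g = trans (sumFin≡sum (λ i → sumFin (g i))) (∑.sum-cong-≗ (sumFin≡sum ∘ g))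

indicator : Bool → ℕ
indicator b = if b then 1 else 0

count≡sumFin : (p : Fin n → Bool) → count p ≡ sumFin (indicator ∘ p)
count≡sumFin {zero}  p = refl
count≡sumFin {suc n} p = cong (indicator (p zero) +_) (count≡sumFin (p ∘ suc))

count-cong : {p q : Fin n → Bool} → p ≗ q → count p ≡ count q
count-cong {p = p} {q} p≗q = begin
  count p                 ≡⟨ count≡sumFin p ⟩
  sumFin (indicator ∘ p)  ≡⟨ sumFin-cong (cong indicator ∘ p≗q) ⟩
  sumFin (indicator ∘ q)  ≡⟨ count≡sumFin q ⟨
  count q                 ∎

count-permute : (p : Fin n → Bool) (π : Permutation m n) → count p ≡ count (p ∘ (π ⟨$⟩ʳ_))
count-permute p π = begin
  count p                                ≡⟨ count≡sumFin p ⟩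
  sumFin (indicator ∘ p)                 ≡⟨ sumFin-permute (indicator ∘ p) π ⟩
  sumFin (indicator ∘ p ∘ (π ⟨$⟩ʳ_))     ≡⟨ count≡sumFin (p ∘ (π ⟨$⟩ʳ_)) ⟨
  count (p ∘ (π ⟨$⟩ʳ_))                  ∎

sumFin-count-transpose : (p : Fin n → Fin n → Bool) →
                         sumFin (λ u → count (p u)) ≡ sumFin (λ u → count (λ v → p v u))
sumFin-count-transpose p = begin
  sumFin (λ u → count (p u))                         ≡⟨ sumFin-cong (λ u → count≡sumFin (p u)) ⟩
  sumFin (λ u → sumFin (λ v → indicator (p u v)))    ≡⟨ sumFin-comm (λ u v → indicator (p u v)) ⟩
  sumFin (λ v → sumFin (λ u → indicator (p u v)))    ≡⟨ sumFin-cong (λ v → count≡sumFin (λ u → p u v)) ⟨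
  sumFin (λ v → count (λ u → p u v))                 ∎

allB≡count-not≡ᵇ0 : (p : Fin n → Bool) → allB p ≡ (count (not ∘ p) ≡ᵇ 0)
allB≡count-not≡ᵇ0 {zero}  p = refl
allB≡count-not≡ᵇ0 {suc n} p with p zero
... | true  = allB≡count-not≡ᵇ0 (p ∘ suc)
... | false = refl

allB-cong : {p q : Fin n → Bool} → p ≗ q → allB p ≡ allB q
allB-cong {zero}  p≗q = refl
allB-cong {suc n} p≗q = cong₂ _∧_ (p≗q zero) (allB-cong (p≗q ∘ suc))

allB-permute : (p : Fin n → Bool) (π : Permutation m n) → allB p ≡ allB (p ∘ (π ⟨$⟩ʳ_))
allB-permute p π = begin
  allB p                                  ≡⟨ allB≡count-not≡ᵇ0 p ⟩
  (count (not ∘ p) ≡ᵇ 0)                  ≡⟨ cong (_≡ᵇ 0) (count-permute (not ∘ p) π) ⟩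
  (count (not ∘ p ∘ (π ⟨$⟩ʳ_)) ≡ᵇ 0)      ≡⟨ allB≡count-not≡ᵇ0 (p ∘ (π ⟨$⟩ʳ_)) ⟨
  allB (p ∘ (π ⟨$⟩ʳ_))                    ∎

sum-map-allFin' : (f : Fin m → ℕ) → sum (map f (allFin' m)) ≡ sumFin f
sum-map-allFin' {zero}  f = refl
sum-map-allFin' {suc m} f = cong (f zero +_) (begin
  sum (map f (map suc (allFin' m)))  ≡⟨ cong sum (map-∘ (allFin' m)) ⟨
  sum (map (f ∘ suc) (allFin' m))    ≡⟨ sum-map-allFin' (f ∘ suc) ⟩
  sumFin (f ∘ suc)                   ∎)

sum-map-concatMap : {B : Set} (F : B → ℕ) (h : A → List B) (xs : List A) →
                    sum (map F (concatMap h xs)) ≡ sum (map (λ x → sum (map F (h x))) xs)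
sum-map-concatMap F h []       = refl
sum-map-concatMap F h (x ∷ xs) = begin
  sum (map F (h x ++ concatMap h xs))          ≡⟨ cong sum (map-++ F (h x) (concatMap h xs)) ⟩
  sum (map F (h x) ++ map F (concatMap h xs))  ≡⟨ sum-++ (map F (h x)) (map F (concatMap h xs)) ⟩
  sum (map F (h x)) + sum (map F (concatMap h xs))
    ≡⟨ cong (sum (map F (h x)) +_) (sum-map-concatMap F h xs) ⟩
  sum (map F (h x)) + sum (map (λ y → sum (map F (h y))) xs) ∎

sumFuns : ∀ n m → ((Fin n → Fin m) → ℕ) → ℕ
sumFuns n m F = sum (map F (allFuns n m))

sumFuns-cong : {F G : (Fin n → Fin m) → ℕ} → F ≗ G → sumFuns n m F ≡ sumFuns n m G
sumFuns-cong {n} {m} F≗G = cong sum (map-cong F≗G (allFuns n m))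

sumFuns-suc : (F : (Fin (suc n) → Fin m) → ℕ) →
              sumFuns (suc n) m F ≡ sumFuns n m (λ g → sumFin (λ i → F (consF i g)))
sumFuns-suc {n} {m} F = begin
  sumFuns (suc n) m F
    ≡⟨ sum-map-concatMap F (λ g → map (λ i → consF i g) (allFin' m)) (allFuns n m) ⟩
  sumFuns n m (λ g → sum (map F (map (λ i → consF i g) (allFin' m))))
    ≡⟨ sumFuns-cong (λ g → trans (cong sum (sym (map-∘ (allFin' m)))) (sum-map-allFin' (λ i → F (consF i g)))) ⟩
  sumFuns n m (λ g → sumFin (λ i → F (consF i g))) ∎

sumFuns-permute : (π : Permutation m m) (F : (Fin n → Fin m) → ℕ) → F Preserves _≗_ ⟶ _≡_ →
                  sumFuns n m F ≡ sumFuns n m (λ f → F ((π ⟨$⟩ʳ_) ∘ f))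
sumFuns-permute {n = zero}      π F F-cong = cong (_+ 0) (F-cong (λ ()))
sumFuns-permute {m} {n = suc n} π F F-cong = begin
  sumFuns (suc n) m F
    ≡⟨ sumFuns-suc F ⟩
  sumFuns n m (λ g → sumFin (λ i → F (consF i g)))
    ≡⟨ sumFuns-cong (λ g → sumFin-permute (λ i → F (consF i g)) π) ⟩
  sumFuns n m H
    ≡⟨ sumFuns-permute π H (λ g≗g′ → sumFin-cong (λ i → F-cong (consF-cong {i = π′ i} g≗g′))) ⟩
  sumFuns n m (λ g → H (π′ ∘ g))
    ≡⟨ sumFuns-cong (λ g → sumFin-cong (λ i → F-cong (consF-∘ i g))) ⟩
  sumFuns n m (λ g → sumFin (λ i → F (π′ ∘ consF i g)))
    ≡⟨ sumFuns-suc (λ f → F (π′ ∘ f)) ⟨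
  sumFuns (suc n) m (λ f → F (π′ ∘ f)) ∎
  where
  π′ : Fin m → Fin m
  π′ = π ⟨$⟩ʳ_
  H : (Fin n → Fin m) → ℕ
  H g = sumFin (λ i → F (consF (π′ i) g))
  consF-cong : ∀ {i} {g g′ : Fin n → Fin m} → g ≗ g′ → consF i g ≗ consF i g′
  consF-cong g≗g′ zero    = refl
  consF-cong g≗g′ (suc x) = g≗g′ x
  consF-∘ : ∀ i (g : Fin n → Fin m) → consF (π′ i) (π′ ∘ g) ≗ π′ ∘ consF i g
  consF-∘ i g zero    = refl
  consF-∘ i g (suc x) = refl

⌊⌋-⇔ : {P Q : Set} → P ⇔ Q → (p? : Dec P) (q? : Dec Q) → ⌊ p? ⌋ ≡ ⌊ q? ⌋
⌊⌋-⇔ P⇔Q p? q? = trans (isYes≗does p?) (trans (does-⇔ P⇔Q p? q?) (sym (isYes≗does q?)))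

==F-permute : (π : Permutation m n) (x y : Fin m) → ((π ⟨$⟩ʳ x) ==F (π ⟨$⟩ʳ y)) ≡ (x ==F y)
==F-permute π x y = ⌊⌋-⇔ (mk⇔ injective (cong (π ⟨$⟩ʳ_))) _ _
  where
  injective : π ⟨$⟩ʳ x ≡ π ⟨$⟩ʳ y → x ≡ y
  injective πx≡πy = trans (sym (inverseˡ π)) (trans (cong (π ⟨$⟩ˡ_) πx≡πy) (inverseˡ π))

opposite-< : {x y : Fin n} → toℕ x < toℕ y → toℕ (opposite y) < toℕ (opposite x)
opposite-< {n} {x} {y} x<y = subst₂ _<_ (sym (opposite-prop y)) (sym (opposite-prop x))
  (∸-monoʳ-< (s<s x<y) (toℕ<n y))

<F-opposite : (x y : Fin n) → (opposite x <F opposite y) ≡ (y <F x)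
<F-opposite x y = ⌊⌋-⇔ (mk⇔ from opposite-<) _ _
  where
  from : toℕ (opposite x) < toℕ (opposite y) → toℕ y < toℕ x
  from o<o = subst₂ (λ a b → toℕ a < toℕ b) (opposite-involutive y) (opposite-involutive x) (opposite-< o<o)

-- coeff G α k is coeffCounts G (lookup α) k. With the type given as a vector a : Fin ℓ → ℕ,
-- reversing it is precomposition with opposite, up to a cast of Fin (length α).
hasCounts : (Fin ℓ → ℕ) → (Fin n → Fin ℓ) → Bool
hasCounts a κ = allB (λ j → count (λ v → κ v ==F j) ≡ᵇ a j)

ascending : SimpleGraph n → (Fin n → Fin n) → (Fin n → Fin ℓ) → Fin n → Fin n → Bool
ascending G L κ u v = adj G u v ∧ (L u <F L v) ∧ (κ u <F κ v)

weight : SimpleGraph n → ℕ → (Fin ℓ → ℕ) → (Fin n → Fin n) → (Fin n → Fin ℓ) → ℕ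
weight G k a L κ = indicator (isLabeling L ∧ isProper G κ ∧ hasCounts a κ ∧ (asc G L κ ≡ᵇ k))

coeffCounts : SimpleGraph n → (Fin ℓ → ℕ) → ℕ → ℕ
coeffCounts {n} {ℓ} G a k = sumFuns n n (λ L → sumFuns n ℓ (weight G k a L))

isLabeling-permute : (π : Permutation n n) (L : Fin n → Fin n) →
                     isLabeling ((π ⟨$⟩ʳ_) ∘ L) ≡ isLabeling L
isLabeling-permute π L = allB-cong (λ u → allB-cong (λ v →
  cong (λ b → not b ∨ (u ==F v)) (==F-permute π (L u) (L v))))

isProper-permute : (G : SimpleGraph n) (π : Permutation ℓ ℓ) (κ : Fin n → Fin ℓ) →
                   isProper G ((π ⟨$⟩ʳ_) ∘ κ) ≡ isProper G κ
isProper-permute G π κ = allB-cong (λ u → allB-cong (λ v →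
  cong (λ b → not (adj G u v) ∨ not b) (==F-permute π (κ u) (κ v))))

hasCounts-permute : (π : Permutation ℓ ℓ) (a : Fin ℓ → ℕ) (κ : Fin n → Fin ℓ) →
                    hasCounts a ((π ⟨$⟩ʳ_) ∘ κ) ≡ hasCounts (a ∘ (π ⟨$⟩ʳ_)) κ
hasCounts-permute {ℓ = ℓ} π a κ = begin
  allB (λ j → count (λ v → π′ (κ v) ==F j) ≡ᵇ a j)
    ≡⟨ allB-permute (λ j → count (λ v → π′ (κ v) ==F j) ≡ᵇ a j) π ⟩
  allB (λ j → count (λ v → π′ (κ v) ==F π′ j) ≡ᵇ a (π′ j))
    ≡⟨ allB-cong (λ j → cong (_≡ᵇ a (π′ j)) (count-cong (λ v → ==F-permute π (κ v) j))) ⟩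
  allB (λ j → count (λ v → κ v ==F j) ≡ᵇ a (π′ j)) ∎
  where
  π′ : Fin ℓ → Fin ℓ
  π′ = π ⟨$⟩ʳ_

ascending-opposite : (G : SimpleGraph n) (L : Fin n → Fin n) (κ : Fin n → Fin ℓ) (u v : Fin n) →
                     ascending G (opposite ∘ L) (opposite ∘ κ) u v ≡ ascending G L κ v u
ascending-opposite G L κ u v = cong₂ _∧_ (SimpleGraph.sym G u v)
  (cong₂ _∧_ (<F-opposite (L u) (L v)) (<F-opposite (κ u) (κ v)))

asc-opposite : (G : SimpleGraph n) (L : Fin n → Fin n) (κ : Fin n → Fin ℓ) →
               asc G (opposite ∘ L) (opposite ∘ κ) ≡ asc G L κ
asc-opposite G L κ = begin
  sumFin (λ u → count (ascending G (opposite ∘ L) (opposite ∘ κ) u))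
    ≡⟨ sumFin-cong (λ u → count-cong (ascending-opposite G L κ u)) ⟩
  sumFin (λ u → count (λ v → ascending G L κ v u))
    ≡⟨ sumFin-count-transpose (ascending G L κ) ⟨
  sumFin (λ u → count (ascending G L κ u)) ∎

weight-cong : (G : SimpleGraph n) (k : ℕ) (a : Fin ℓ → ℕ) {L L′ : Fin n → Fin n} {κ κ′ : Fin n → Fin ℓ} →
              L ≗ L′ → κ ≗ κ′ → weight G k a L κ ≡ weight G k a L′ κ′
weight-cong G k a {L} {L′} {κ} {κ′} L≗L′ κ≗κ′ =
  cong indicator (cong₂ _∧_ labeling (cong₂ _∧_ proper (cong₂ _∧_ counts (cong (_≡ᵇ k) ascents))))
  where
  labeling : isLabeling L ≡ isLabeling L′
  labeling = allB-cong (λ u → allB-cong (λ v →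
    cong₂ (λ x y → not (x ==F y) ∨ (u ==F v)) (L≗L′ u) (L≗L′ v)))
  proper : isProper G κ ≡ isProper G κ′
  proper = allB-cong (λ u → allB-cong (λ v →
    cong₂ (λ x y → not (adj G u v) ∨ not (x ==F y)) (κ≗κ′ u) (κ≗κ′ v)))
  counts : hasCounts a κ ≡ hasCounts a κ′
  counts = allB-cong (λ j → cong (_≡ᵇ a j) (count-cong (λ v → cong (_==F j) (κ≗κ′ v))))
  ascents : asc G L κ ≡ asc G L′ κ′
  ascents = sumFin-cong (λ u → count-cong (λ v →
    cong₂ (λ l c → adj G u v ∧ l ∧ c) (cong₂ _<F_ (L≗L′ u) (L≗L′ v)) (cong₂ _<F_ (κ≗κ′ u) (κ≗κ′ v))))

weight-opposite : (G : SimpleGraph n) (k : ℕ) (a : Fin ℓ → ℕ) (L : Fin n → Fin n) (κ : Fin n → Fin ℓ) →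
                  weight G k a (opposite ∘ L) (opposite ∘ κ) ≡ weight G k (a ∘ opposite) L κ
weight-opposite G k a L κ = cong indicator
  (cong₂ _∧_ (isLabeling-permute Perm.reverse L)
  (cong₂ _∧_ (isProper-permute G Perm.reverse κ)
  (cong₂ _∧_ (hasCounts-permute Perm.reverse a κ)
             (cong (_≡ᵇ k) (asc-opposite G L κ)))))

coeffCounts-opposite : (G : SimpleGraph n) (a : Fin ℓ → ℕ) (k : ℕ) →
                       coeffCounts G a k ≡ coeffCounts G (a ∘ opposite) k
coeffCounts-opposite {n} {ℓ} G a k = begin
  sumFuns n n (λ L → sumFuns n ℓ (weight G k a L))
    ≡⟨ sumFuns-permute Perm.reverse (λ L → sumFuns n ℓ (weight G k a L)) (λ L≗L′ → sumFuns-cong {n} {ℓ} (λ κ → weight-cong G k a L≗L′ (λ _ → refl))) ⟩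
  sumFuns n n (λ L → sumFuns n ℓ (weight G k a (opposite ∘ L)))
    ≡⟨ sumFuns-cong (λ L → sumFuns-permute Perm.reverse (weight G k a (opposite ∘ L)) (weight-cong G k a (λ _ → refl))) ⟩
  sumFuns n n (λ L → sumFuns n ℓ (λ κ → weight G k a (opposite ∘ L) (opposite ∘ κ)))
    ≡⟨ sumFuns-cong (λ L → sumFuns-cong (weight-opposite G k a L)) ⟩
  sumFuns n n (λ L → sumFuns n ℓ (weight G k (a ∘ opposite) L)) ∎

coeffCounts-cast : (G : SimpleGraph n) (k : ℕ) {ℓ′ : ℕ} (e : ℓ ≡ ℓ′) (a : Fin ℓ → ℕ) (b : Fin ℓ′ → ℕ) →
                   (∀ j → a j ≡ b (cast e j)) → coeffCounts G a k ≡ coeffCounts G b k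
coeffCounts-cast G k refl a b a≗b∘cast = sumFuns-cong (λ L → sumFuns-cong (λ κ →
  cong (λ t → indicator (isLabeling L ∧ isProper G κ ∧ t ∧ (asc G L κ ≡ᵇ k)))
       (allB-cong (λ j → cong (count (λ v → κ v ==F j) ≡ᵇ_)
                              (trans (a≗b∘cast j) (cong b (cast-is-id refl j)))))))

lookup? : List A → ℕ → Maybe A
lookup? []       k       = nothing
lookup? (x ∷ xs) zero    = just x
lookup? (x ∷ xs) (suc k) = lookup? xs k

lookup?-toℕ : (xs : List A) (i : Fin (length xs)) → lookup? xs (toℕ i) ≡ just (lookup xs i)
lookup?-toℕ (x ∷ xs) zero    = refl
lookup?-toℕ (x ∷ xs) (suc i) = lookup?-toℕ xs i

lookup?-++ˡ : (xs ys : List A) {k : ℕ} → k < length xs → lookup? (xs ++ ys) k ≡ lookup? xs k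
lookup?-++ˡ (x ∷ xs) ys {zero}  k<len       = refl
lookup?-++ˡ (x ∷ xs) ys {suc k} (s<s k<len) = lookup?-++ˡ xs ys k<len

lookup?-++-length : (xs : List A) (y : A) (ys : List A) → lookup? (xs ++ y ∷ ys) (length xs) ≡ just y
lookup?-++-length []       y ys = refl
lookup?-++-length (x ∷ xs) y ys = lookup?-++-length xs y ys

lookup?-reverse : (xs : List A) {k : ℕ} → k < length xs →
                  lookup? (reverse xs) k ≡ lookup? xs (length xs ∸ suc k)
lookup?-reverse (x ∷ xs) {k} k<1+len rewrite unfold-reverse x xs with m<1+n⇒m<n∨m≡n k<1+len
... | inj₁ k<len = begin
  lookup? (reverse xs ++ [ x ]) k     ≡⟨ lookup?-++ˡ (reverse xs) [ x ] (subst (k <_) (sym (length-reverse xs)) k<len) ⟩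
  lookup? (reverse xs) k              ≡⟨ lookup?-reverse xs k<len ⟩
  lookup? xs (length xs ∸ suc k)      ≡⟨ cong (lookup? (x ∷ xs)) (+-∸-assoc 1 k<len) ⟨
  lookup? (x ∷ xs) (length xs ∸ k)    ∎
... | inj₂ refl = begin
  lookup? (reverse xs ++ [ x ]) (length xs)
    ≡⟨ cong (lookup? (reverse xs ++ [ x ])) (length-reverse xs) ⟨
  lookup? (reverse xs ++ [ x ]) (length (reverse xs))
    ≡⟨ lookup?-++-length (reverse xs) x [] ⟩
  just x
    ≡⟨ cong (lookup? (x ∷ xs)) (n∸n≡0 (length xs)) ⟨
  lookup? (x ∷ xs) (length xs ∸ length xs) ∎

lookup-reverse : (xs : List A) (i : Fin (length xs)) →
                 lookup (reverse xs) (cast (sym (length-reverse xs)) i) ≡ lookup xs (opposite i)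
lookup-reverse xs i = just-injective (begin
  just (lookup (reverse xs) i′)         ≡⟨ lookup?-toℕ (reverse xs) i′ ⟨
  lookup? (reverse xs) (toℕ i′)          ≡⟨ cong (lookup? (reverse xs)) (toℕ-cast _ i) ⟩
  lookup? (reverse xs) (toℕ i)           ≡⟨ lookup?-reverse xs (toℕ<n i) ⟩
  lookup? xs (length xs ∸ suc (toℕ i))   ≡⟨ cong (lookup? xs) (opposite-prop i) ⟨
  lookup? xs (toℕ (opposite i))          ≡⟨ lookup?-toℕ xs (opposite i) ⟩
  just (lookup xs (opposite i))          ∎)
  where
  i′ : Fin (length (reverse xs))
  i′ = cast (sym (length-reverse xs)) i

theorem3p5 : (n : ℕ) (G : SimpleGraph n) (α : List ℕ) → IsComposition n α →
             (k : ℕ) → coeff G α k ≡ coeff G (reverse α) k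
theorem3p5 n G α _ k = begin
  coeff G α k                               ≡⟨⟩
  coeffCounts G (lookup α) k                ≡⟨ coeffCounts-opposite G (lookup α) k ⟩
  coeffCounts G (lookup α ∘ opposite) k     ≡⟨ coeffCounts-cast G k (sym (length-reverse α)) _ _ lookup-opposite ⟩
  coeffCounts G (lookup (reverse α)) k      ≡⟨⟩
  coeff G (reverse α) k                     ∎
  where
  lookup-opposite : ∀ j → lookup α (opposite j) ≡ lookup (reverse α) (cast (sym (length-reverse α)) j)
  lookup-opposite j = sym (lookup-reverse α j)
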